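{- Let $G=B(H)$ for some graph $H$. Then $KB_e(G)$ is a cycle, a path, or contains an induced $(n,m)$-necklace with $n\geq 6$ and $m\geq 1$ whose cycle has good neighbors.
   Context: All graphs are finite, simple and undirected (and, as a standing convention, connected). A biclique of a graph is a maximal induced complete bipartite subgraph. The edge-biclique graph $KB_e(G)$ has one vertex for each biclique of $G$, two vertices being adjacent when the corresponding bicliques share at least one edge. The burgeon graph $B(H)$ is obtained by replacing each vertex $v$ of $H$ by a clique $C_v$ on $d(v)$ vertices, in bijection with the edges of $H$ incident to $v$, and, for each edge $uv$ of $H$, joining the vertex of $C_u$ corresponding to $uv$ with the vertex of $C_v$ corresponding to $uv$. For $n\ge 3$, $m\ge 1$, the $(n,m)$-necklace is the graph on $n+m$ vertices consisting of an induced cycle $C_n$ and a complete graph $K_m$ such that, for one fixed edge $e$ of $C_n$, every vertex of $K_m$ is adjacent to both endpoints of $e$ and to no other vertex of $C_n$. An induced cycle $C=v_0\ldots v_{n-1}$ ($n\ge 5$) of a graph $X$ has good neighbors if for every vertex $v\in V(X)\setminus V(C)$ and every $i$ (indices mod $n$), if $v$ is adjacent to both $v_{i-1}$ and $v_{i+1}$ then $v$ is adjacent to $v_i$. -}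

module Defs where

open import Data.Nat using (ℕ; zero; suc; _≤_)
open import Data.Fin using (Fin; toℕ)
open import Data.Bool using (Bool; true; false; T)
open import Data.Product using (Σ; ∃; ∃-syntax; _×_; _,_; proj₁)
open import Data.Sum using (_⊎_; inj₁; inj₂)
open import Relation.Nullary using (¬_)
open import Relation.Binary.PropositionalEquality using (_≡_; _≢_)

_⟺_ : Set → Set → Set
A ⟺ B = (A → B) × (B → A)

record SimpleGraph : Set where
  field
    n      : ℕ
    adj    : Fin n → Fin n → Bool
    sym    : ∀ i j → adj i j ≡ adj j i
    irrefl : ∀ i → adj i i ≡ false

-- For H and B(H) the vertex equality is _≡_;
-- for KB_e(G) two bicliques are the same vertex iff they have the same
-- vertex set.

record Graph : Set₁ where
  field
    V   : Set
    _≈_ : V → V → Set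
    Adj : V → V → Set

open Graph public

toGraph : SimpleGraph → Graph
toGraph H = record
  { V = Fin (SimpleGraph.n H)
  ; _≈_ = _≡_
  ; Adj = λ i j → T (SimpleGraph.adj H i j) }

data Reach (G : Graph) : V G → V G → Set where
  here : ∀ {v} → Reach G v v
  step : ∀ {u w v} → Adj G u w → Reach G w v → Reach G u v

Connected : Graph → Set
Connected G = V G × (∀ u v → Reach G u v)

-- Burgeon graph B(H): the clique C_v consists of the "darts" (v , w) with
-- vw ∈ E(H) (one vertex per edge incident to v); darts (v , w) and (v , w')
-- with w ≠ w' are adjacent (C_v is a clique), and the dart (u , v) is
-- adjacent to the dart (v , u) (the edge uv of H).

Dart : SimpleGraph → Set
Dart H = Σ (Fin (SimpleGraph.n H) × Fin (SimpleGraph.n H))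
           (λ p → T (SimpleGraph.adj H (proj₁ p) (Data.Product.proj₂ p)))

Burgeon : SimpleGraph → Graph
Burgeon H = record
  { V = Dart H
  ; _≈_ = _≡_
  ; Adj = λ { ((u , w) , _) ((u' , w') , _) →
               (u ≡ u' × w ≢ w') ⊎ (u ≡ w' × w ≡ u') } }

Subset : Graph → Set
Subset G = V G → Bool

_∈_ : ∀ {G} → V G → Subset G → Set
v ∈ S = S v ≡ true

_⊆_ : ∀ {G} → Subset G → Subset G → Set
_⊆_ {G} S T' = ∀ (v : V G) → _∈_ {G} v S → _∈_ {G} v T'

IsCompleteBipartite : (G : Graph) → Subset G → Set
IsCompleteBipartite G S =
  Σ (V G → Bool) λ side →
    (∃[ x ] (_∈_ {G} x S × side x ≡ true)) ×
    (∃[ y ] (_∈_ {G} y S × side y ≡ false)) ×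
    (∀ u v → _∈_ {G} u S → _∈_ {G} v S → Adj G u v ⟺ (side u ≢ side v))

IsBiclique : (G : Graph) → Subset G → Set
IsBiclique G S =
  IsCompleteBipartite G S ×
  (∀ (S' : Subset G) → IsCompleteBipartite G S' → _⊆_ {G} S S' → _⊆_ {G} S' S)

KBe : Graph → Graph
KBe G = record
  { V = Σ (Subset G) (IsBiclique G)
  ; _≈_ = λ A B → ∀ v → proj₁ A v ≡ proj₁ B v
  ; Adj = λ A B → ¬ (∀ v → proj₁ A v ≡ proj₁ B v) ×
                  (∃[ u ] ∃[ v ] (_∈_ {G} u (proj₁ A) × _∈_ {G} v (proj₁ A) ×
                                  _∈_ {G} u (proj₁ B) × _∈_ {G} v (proj₁ B) ×
                                  Adj G u v)) }

Next : (k : ℕ) → Fin k → Fin k → Set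
Next k i j = (suc (toℕ i) ≡ toℕ j) ⊎ (suc (toℕ i) ≡ k × toℕ j ≡ 0)

CycleAdj : (k : ℕ) → Fin k → Fin k → Set
CycleAdj k i j = Next k i j ⊎ Next k j i

PathAdj : (k : ℕ) → Fin k → Fin k → Set
PathAdj k i j = (suc (toℕ i) ≡ toℕ j) ⊎ (suc (toℕ j) ≡ toℕ i)

-- (n , m)-necklace on Fin n ⊎ Fin m: the inj₁ part is the cycle C_n,
-- the inj₂ part is K_m, and every vertex of K_m is adjacent exactly to
-- the endpoints 0 and 1 of the fixed edge {0 , 1} of C_n.
NecklaceAdj : (n m : ℕ) → Fin n ⊎ Fin m → Fin n ⊎ Fin m → Set
NecklaceAdj n m (inj₁ i) (inj₁ j) = CycleAdj n i j
NecklaceAdj n m (inj₂ a) (inj₂ b) = a ≢ b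
NecklaceAdj n m (inj₁ i) (inj₂ a) = (toℕ i ≡ 0) ⊎ (toℕ i ≡ 1)
NecklaceAdj n m (inj₂ a) (inj₁ i) = (toℕ i ≡ 0) ⊎ (toℕ i ≡ 1)

InducedEmbedding : (G : Graph) {W : Set} → (W → W → Set) → (W → V G) → Set
InducedEmbedding G {W} A f =
  (∀ a b → _≈_ G (f a) (f b) → a ≡ b) ×
  (∀ a b → Adj G (f a) (f b) ⟺ A a b)

IsoToFin : (G : Graph) (k : ℕ) → (Fin k → Fin k → Set) → Set
IsoToFin G k A =
  Σ (Fin k → V G) λ f → InducedEmbedding G A f × (∀ v → ∃[ i ] _≈_ G (f i) v)

IsCycle : Graph → Set
IsCycle G = ∃[ k ] (3 ≤ k × IsoToFin G k (CycleAdj k))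

IsPath : Graph → Set
IsPath G = ∃[ k ] (1 ≤ k × IsoToFin G k (PathAdj k))

GoodNeighbors : (G : Graph) (n : ℕ) → (Fin n → V G) → Set
GoodNeighbors G n c =
  ∀ (v : V G) → (∀ i → ¬ _≈_ G (c i) v) →
  ∀ (i j k : Fin n) → Next n i j → Next n j k →
  Adj G v (c i) → Adj G v (c k) → Adj G v (c j)

HasGoodNecklace : Graph → Set
HasGoodNecklace G =
  ∃[ n ] ∃[ m ] (6 ≤ n × 1 ≤ m ×
    Σ (Fin n ⊎ Fin m → V G) λ f →
      InducedEmbedding G (NecklaceAdj n m) f ×
      GoodNeighbors G n (λ i → f (inj₁ i)))

-- If some vertex of H has two neighbours, the bicliques of B(H) are exactly the
-- induced paths (p,v) – (v,p) – (v,q) of darts, one for each wedge (v; p, q) with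
-- p ≠ q neighbours of v; otherwise the connected B(H) is a single edge and KB_e
-- has a single vertex. Two wedge bicliques share an edge iff the wedges differ only
-- in their far end, are each other's swap (v; q, p), or are (v; p, q) and (p; v, r).
-- If H contains a claw v; a, b, c with one more edge at v or at a, the six wedges
-- at v with ends in {a, b, c} form an induced 6-cycle, and a wedge through the
-- extra edge is adjacent exactly to the two with near end a: a (6,1)-necklace. A
-- wedge off the cycle that is adjacent to a cycle wedge determines the near end of
-- that wedge, and cycle wedges at distance two have different near ends, so the
-- cycle has good neighbours. Otherwise every wedge has at most two neighbours, the
-- wedge graph is connected because B(H) is, and a connected graph of maximum degree
-- two is a path or a cycle.

module Submission where

open import Defs
open import Data.Nat using (ℕ; zero; suc; pred; _+_; _*_; _≤_; _<_; z≤n; s≤s; s≤s⁻¹; _≤?_)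
  renaming (_≟_ to _≟ℕ_)
open import Data.Nat.Properties
  using (≤-refl; m≤n⇒m<n∨m≡n; m≤n⇒m≤1+n; <⇒≤; <⇒≢; n<1+n; +-identityʳ; +-suc; 1+n≰n)
open import Data.Fin using (Fin; toℕ; fromℕ<; combine)
open import Data.Fin.Patterns using (0F; 1F; 2F; 3F; 4F; 5F)
open import Data.Fin.Properties
  using (toℕ<n; toℕ-fromℕ<; toℕ-injective; pigeonhole; any?; all?; combine-injective)
  renaming (_≟_ to _≟ᶠ_)
open import Data.Bool using (Bool; true; false; T) renaming (_≟_ to _≟ᵇ_)
open import Data.Bool.Properties using (T-irrelevant; ¬-not)
open import Data.Product using (Σ; ∃; ∃-syntax; _×_; _,_; proj₁; proj₂)
open import Data.Product.Properties using (≡-dec)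
open import Data.Sum using (_⊎_; inj₁; inj₂)
import Data.Sum as Sum
open import Data.Empty using (⊥; ⊥-elim; ⊥-elim-irr)
open import Data.Unit using (⊤; tt)
open import Relation.Nullary using (¬_; Dec; yes; no; does)
open import Relation.Nullary.Decidable
  using (recompute; T?; map′; toWitness; _×-dec_; _⊎-dec_; _→-dec_; ¬?; dec-true; dec-false)
open import Relation.Binary.Definitions using (DecidableEquality)
open import Relation.Binary.PropositionalEquality
  using (_≡_; _≢_; refl; sym; trans; cong; cong₂; subst; subst₂; ≢-sym)

reach-closed : (G : Graph) (P : V G → Set) → (∀ {u w} → P u → Adj G u w → P w) →
  ∀ {u v} → Reach G u v → P u → P v
reach-closed G P closed here pu = pu
reach-closed G P closed (step a r) pu = reach-closed G P closed r (closed pu a)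

reach-trans : (G : Graph) → ∀ {u v w} → Reach G u v → Reach G v w → Reach G u w
reach-trans G here r = r
reach-trans G (step a r) r' = step a (reach-trans G r r')

reach-sym : (G : Graph) → (∀ {u v} → Adj G u v → Adj G v u) → ∀ {u v} → Reach G u v → Reach G v u
reach-sym G sym-adj here = here
reach-sym G sym-adj (step a r) = reach-trans G (reach-sym G sym-adj r) (step (sym-adj a) here)

relGraph : (W : Set) → (W → W → Set) → Graph
relGraph W A = record { V = W ; _≈_ = _≡_ ; Adj = A }

IsoToFin-transport : {W : Set} {A : W → W → Set} (G : Graph) (h : W → V G) →
  (∀ {a b} → _≈_ G (h a) (h b) → a ≡ b) →
  (∀ a b → Adj G (h a) (h b) ⟺ A a b) →
  (∀ v → ∃[ a ] _≈_ G (h a) v) →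
  ∀ {k R} → IsoToFin (relGraph W A) k R → IsoToFin G k R
IsoToFin-transport G h h-inj h-adj h-onto (f , (f-inj , f-adj) , f-onto) =
  (λ i → h (f i)) ,
  ((λ a b e → f-inj a b (h-inj e)) ,
   (λ a b → (λ x → proj₁ (f-adj a b) (proj₁ (h-adj (f a) (f b)) x)) ,
            (λ x → proj₂ (h-adj (f a) (f b)) (proj₂ (f-adj a b) x)))) ,
  λ v → let (a , ha) = h-onto v ; (i , fi) = f-onto a
        in i , subst (λ z → _≈_ G (h z) v) (sym fi) ha

≤-suc-cases : ∀ {i k} → i ≤ suc k → i ≤ k ⊎ i ≡ suc k
≤-suc-cases i≤ with m≤n⇒m<n∨m≡n i≤
... | inj₁ i<1+k = inj₁ (s≤s⁻¹ i<1+k)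
... | inj₂ e = inj₂ e

does-true : ∀ {P : Set} (p? : Dec P) → does p? ≡ true → P
does-true (yes p) _ = p

⟺-trans : ∀ {P Q R : Set} → P ⟺ Q → Q ⟺ R → P ⟺ R
⟺-trans (f , g) (h , k) = (λ p → h (f p)) , (λ r → g (k r))

KBe-adjacent-respˡ : ∀ {G} {X X' Y : V (KBe G)} → _≈_ (KBe G) X X' → Adj (KBe G) X Y → Adj (KBe G) X' Y
KBe-adjacent-respˡ X≈X' (X≉Y , u , w , u∈X , w∈X , rest) =
  (λ X'≈Y → X≉Y λ d → trans (X≈X' d) (X'≈Y d)) ,
  u , w , trans (sym (X≈X' u)) u∈X , trans (sym (X≈X' w)) w∈X , rest

-- Connected graphs of maximum degree two

-- CycleAdj n a b and PathAdj n a b are definitionally CycleRel n (toℕ a) (toℕ b)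
-- and PathRel (toℕ a) (toℕ b).
NextRel : ℕ → ℕ → ℕ → Set
NextRel n i j = (suc i ≡ j) ⊎ (suc i ≡ n × j ≡ 0)

CycleRel : ℕ → ℕ → ℕ → Set
CycleRel n i j = NextRel n i j ⊎ NextRel n j i

PathRel : ℕ → ℕ → Set
PathRel i j = (suc i ≡ j) ⊎ (suc j ≡ i)

module MaxDegreeTwo
  {W : Set} (_≟_ : DecidableEquality W) (A : W → W → Set) (A? : ∀ x y → Dec (A x y))
  (A-sym : ∀ {x y} → A x y → A y x) (A-irrefl : ∀ {x} → ¬ A x x)
  (deg≤2 : ∀ {x y z w} → A x y → A x z → A x w → y ≡ z ⊎ y ≡ w ⊎ z ≡ w)
  (search : ∀ (P : W → Set) → (∀ y → Dec (P y)) → Dec (∃ P))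
  {M : ℕ} (code : W → Fin M) (code-injective : ∀ {x y} → code x ≡ code y → x ≡ y)
  where

  Γ : Graph
  Γ = relGraph W A

  other-neighbour : ∀ {x a b y} → A x a → A x b → a ≢ b → A x y → y ≡ a ⊎ y ≡ b
  other-neighbour xa xb a≢b xy with deg≤2 xy xa xb
  ... | inj₁ e = inj₁ e
  ... | inj₂ (inj₁ e) = inj₂ e
  ... | inj₂ (inj₂ e) = ⊥-elim (a≢b e)

  record SimplePath (k : ℕ) (f : ℕ → W) : Set where
    field
      injective : ∀ {i j} → i ≤ k → j ≤ k → f i ≡ f j → i ≡ j
      linked    : ∀ {i} → i < k → A (f i) (f (suc i))

  open SimplePath

  trivialPath : ∀ x → SimplePath 0 (λ _ → x)
  injective (trivialPath x) z≤n z≤n _ = refl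
  linked (trivialPath x) ()

  OnPath : ℕ → (ℕ → W) → W → Set
  OnPath k f y = ∃[ i ] (i ≤ k × f i ≡ y)

  onPath-index : ∀ {k f y} → OnPath k f y → ∃[ i ] f (toℕ {suc k} i) ≡ y
  onPath-index {f = f} (i , i≤k , e) = fromℕ< (s≤s i≤k) , trans (cong f (toℕ-fromℕ< (s≤s i≤k))) e

  onPath? : ∀ k f y → Dec (OnPath k f y)
  onPath? k f y = map′ (λ (i , e) → toℕ i , s≤s⁻¹ (toℕ<n i) , e) onPath-index
                       (any? λ i → f (toℕ i) ≟ y)

  snoc : (ℕ → W) → ℕ → W → ℕ → W
  snoc f k y i with i ≤? k
  ... | yes _ = f i
  ... | no  _ = y

  snoc-old : ∀ f {k} y {i} → i ≤ k → snoc f k y i ≡ f i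
  snoc-old f {k} y {i} i≤k with i ≤? k
  ... | yes _ = refl
  ... | no i≰k = ⊥-elim (i≰k i≤k)

  snoc-new : ∀ f k y → snoc f k y (suc k) ≡ y
  snoc-new f k y with suc k ≤? k
  ... | yes 1+k≤k = ⊥-elim (1+n≰n 1+k≤k)
  ... | no _ = refl

  extend : ∀ {k f y} → SimplePath k f → A (f k) y → ¬ OnPath k f y →
    SimplePath (suc k) (snoc f k y)
  extend {k} {f} {y} path fk~y fresh = record { injective = inj ; linked = link }
    where
    old : ∀ {i} → i ≤ k → snoc f k y i ≡ f i
    old = snoc-old f y
    inj : ∀ {i j} → i ≤ suc k → j ≤ suc k → snoc f k y i ≡ snoc f k y j → i ≡ j
    inj i≤ j≤ e with ≤-suc-cases i≤ | ≤-suc-cases j≤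
    ... | inj₁ i≤k | inj₁ j≤k = injective path i≤k j≤k (trans (sym (old i≤k)) (trans e (old j≤k)))
    ... | inj₁ i≤k | inj₂ refl =
      ⊥-elim (fresh (_ , i≤k , trans (sym (old i≤k)) (trans e (snoc-new f k y))))
    ... | inj₂ refl | inj₁ j≤k =
      ⊥-elim (fresh (_ , j≤k , trans (sym (old j≤k)) (trans (sym e) (snoc-new f k y))))
    ... | inj₂ refl | inj₂ refl = refl
    link : ∀ {i} → i < suc k → A (snoc f k y i) (snoc f k y (suc i))
    link (s≤s i≤k) with m≤n⇒m<n∨m≡n i≤k
    ... | inj₁ i<k = subst₂ A (sym (old i≤k)) (sym (old i<k)) (linked path i<k)
    ... | inj₂ refl = subst₂ A (sym (old ≤-refl)) (sym (snoc-new f k y)) fk~y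

  path-length-bound : ∀ {k f} → SimplePath k f → M ≤ k → ⊥
  path-length-bound {f = f} path M≤k with pigeonhole (s≤s M≤k) (λ i → code (f (toℕ i)))
  ... | i , j , i<j , e =
    <⇒≢ i<j (injective path (s≤s⁻¹ (toℕ<n i)) (s≤s⁻¹ (toℕ<n j)) (code-injective e))

  NotPrevious : ℕ → (ℕ → W) → W → Set
  NotPrevious zero    f y = ⊤
  NotPrevious (suc j) f y = y ≢ f j

  notPrevious? : ∀ k f y → Dec (NotPrevious k f y)
  notPrevious? zero    f y = yes tt
  notPrevious? (suc j) f y with y ≟ f j
  ... | yes e = no λ ne → ne e
  ... | no ne = yes ne

  Stuck : ℕ → (ℕ → W) → Set
  Stuck k f = ∀ {y} → A (f k) y → ∃[ j ] (suc j ≡ k × y ≡ f j)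

  stuck : ∀ k f → ¬ (∃ λ y → A (f k) y × NotPrevious k f y) → Stuck k f
  stuck zero    f none {y} a = ⊥-elim (none (y , a , tt))
  stuck (suc j) f none {y} a with y ≟ f j
  ... | yes e = j , refl , e
  ... | no ne = ⊥-elim (none (y , a , ne))

  stuck-end : ∀ {k f} → Stuck k f → ∀ {y z} → A (f k) y → A (f k) z → y ≡ z
  stuck-end st a b with st a | st b
  ... | j , refl , refl | .j , refl , refl = refl

  -- Landing anywhere but at the start, the chord would give its endpoint three
  -- distinct neighbours.
  chord-to-start : ∀ {k f i} → SimplePath k f → i ≤ k → A (f k) (f i) → NotPrevious k f (f i) →
    i ≡ 0 × 2 ≤ k
  chord-to-start {zero} {i = zero} path i≤k a np = ⊥-elim (A-irrefl a)
  chord-to-start {suc j} {f} {i} path i≤k a np with ≤-suc-cases i≤k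
  ... | inj₂ refl = ⊥-elim (A-irrefl a)
  ... | inj₁ i≤j with m≤n⇒m<n∨m≡n i≤j
  ...   | inj₂ refl = ⊥-elim (np refl)
  ...   | inj₁ i<j with i | j
  ...     | zero | suc j' = refl , s≤s (s≤s z≤n)
  ...     | suc i' | _ = ⊥-elim (three-neighbours (deg≤2 back forth chord))
    where
    back    = A-sym (linked path (m≤n⇒m≤1+n (<⇒≤ i<j)))
    forth   = linked path (m≤n⇒m≤1+n i<j)
    chord   = A-sym a
    three-neighbours : f i' ≡ f (suc (suc i')) ⊎ f i' ≡ f (suc _) ⊎ f (suc (suc i')) ≡ f (suc _) → ⊥
    three-neighbours (inj₁ e) = <⇒≢ (m≤n⇒m≤1+n (n<1+n i'))
      (injective path (m≤n⇒m≤1+n (<⇒≤ (<⇒≤ i<j))) (m≤n⇒m≤1+n i<j) e)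
    three-neighbours (inj₂ (inj₁ e)) = <⇒≢ (m≤n⇒m≤1+n (<⇒≤ i<j))
      (injective path (m≤n⇒m≤1+n (<⇒≤ (<⇒≤ i<j))) ≤-refl e)
    three-neighbours (inj₂ (inj₂ e)) = <⇒≢ i<j (cong pred (injective path (m≤n⇒m≤1+n i<j) ≤-refl e))

  data Walk (x : W) : Set where
    cycle : ∀ k f → 2 ≤ k → f 0 ≡ x → SimplePath k f → A (f k) (f 0) → Walk x
    path  : ∀ k f → f 0 ≡ x → SimplePath k f → Stuck k f → Walk x

  grow : ∀ fuel k f → SimplePath k f → M ≤ k + fuel → Walk (f 0)
  grow fuel k f p bound with search (λ y → A (f k) y × NotPrevious k f y)
                                    (λ y → A? (f k) y ×-dec notPrevious? k f y)
  ... | no none = path k f refl p (stuck k f none)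
  ... | yes (y , a , np) with onPath? k f y
  ...   | yes (i , i≤k , refl) =
          let (i≡0 , 2≤k) = chord-to-start p i≤k a np
          in cycle k f 2≤k refl p (subst (λ j → A (f k) (f j)) i≡0 a)
  grow zero k f p bound | yes _ | no _ =
    ⊥-elim (path-length-bound p (subst (M ≤_) (+-identityʳ k) bound))
  grow (suc fuel) k f p bound | yes (y , a , _) | no fresh
    with grow fuel (suc k) (snoc f k y) (extend p a fresh) (subst (M ≤_) (+-suc k fuel) bound)
  ... | cycle k' g 2≤k' g0 p' closing = cycle k' g 2≤k' (trans g0 (snoc-old f {k} y z≤n)) p' closing
  ... | path k' g g0 p' st = path k' g (trans g0 (snoc-old f {k} y z≤n)) p' st

  walk : ∀ x → Walk x
  walk x = grow M 0 (λ _ → x) (trivialPath x) ≤-refl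

  neighbour-among : ∀ {k f i y b c} (R : ℕ → Set) → SimplePath k f → b ≤ k → c ≤ k → b ≢ c →
    A (f i) (f b) → A (f i) (f c) → R b → R c → A (f i) y → ∃[ j ] (j ≤ k × y ≡ f j × R j)
  neighbour-among R p b≤k c≤k b≢c ab ac rb rc a
    with other-neighbour ab ac (λ e → b≢c (injective p b≤k c≤k e)) a
  ... | inj₁ e = _ , b≤k , e , rb
  ... | inj₂ e = _ , c≤k , e , rc

  cycle-neighbour : ∀ {k f y} → SimplePath k f → 2 ≤ k → A (f k) (f 0) → ∀ {i} → i ≤ k →
    A (f i) y → ∃[ j ] (j ≤ k × y ≡ f j × CycleRel (suc k) i j)
  cycle-neighbour {suc (suc m)} p (s≤s (s≤s z≤n)) closing {i} i≤k with i | ≤-suc-cases i≤k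
  ... | _ | inj₂ refl = neighbour-among (CycleRel _ _) p z≤n (m≤n⇒m≤1+n ≤-refl) (λ ())
        closing (A-sym (linked p ≤-refl)) (inj₁ (inj₂ (refl , refl))) (inj₂ (inj₁ refl))
  ... | zero | inj₁ _ = neighbour-among (CycleRel _ _) p (s≤s z≤n) ≤-refl (λ ())
        (linked p (s≤s z≤n)) (A-sym closing) (inj₁ (inj₁ refl)) (inj₂ (inj₂ (refl , refl)))
  ... | suc i | inj₁ (s≤s i≤m) = neighbour-among (CycleRel _ _) p
        (m≤n⇒m≤1+n (m≤n⇒m≤1+n i≤m)) (s≤s (s≤s i≤m)) (<⇒≢ (m≤n⇒m≤1+n (n<1+n i)))
        (A-sym (linked p (s≤s (m≤n⇒m≤1+n i≤m)))) (linked p (s≤s (s≤s i≤m)))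
        (inj₂ (inj₁ refl)) (inj₁ (inj₁ refl))

  path-neighbour : ∀ {k f y} → SimplePath k f → (∀ {y z} → A (f 0) y → A (f 0) z → y ≡ z) →
    Stuck k f → ∀ {i} → i ≤ k → A (f i) y → ∃[ j ] (j ≤ k × y ≡ f j × PathRel i j)
  path-neighbour p start-end st {i} i≤k a with i | m≤n⇒m<n∨m≡n i≤k
  ... | _ | inj₂ refl = let (j , 1+j≡k , e) = st a
                    in j , subst (j ≤_) 1+j≡k (m≤n⇒m≤1+n ≤-refl) , e , inj₂ 1+j≡k
  ... | zero | inj₁ 0<k = 1 , 0<k , start-end a (linked p 0<k) , inj₁ refl
  ... | suc i | inj₁ i<k = neighbour-among (PathRel _) p
        (<⇒≤ (<⇒≤ i<k)) i<k (<⇒≢ (m≤n⇒m≤1+n (n<1+n i)))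
        (A-sym (linked p (<⇒≤ i<k))) (linked p i<k) (inj₂ refl) (inj₁ refl) a

  spanning-iso : ∀ {k f} (R : ℕ → ℕ → Set) → SimplePath k f →
    (∀ {i y} → i ≤ k → A (f i) y → ∃[ j ] (j ≤ k × y ≡ f j × R i j)) →
    (∀ {i j} → i ≤ k → j ≤ k → R i j → A (f i) (f j)) →
    (∀ v → Reach Γ (f 0) v) →
    IsoToFin Γ (suc k) (λ a b → R (toℕ a) (toℕ b))
  spanning-iso {k} {f} R p neighbour edge reach =
    (λ a → f (toℕ a)) ,
    ((λ a b e → toℕ-injective (injective p (bound a) (bound b) e)) ,
     (λ a b → forward a b , edge (bound a) (bound b))) ,
    λ v → onPath-index (reach-closed Γ (OnPath k f) closed (reach v) (0 , z≤n , refl))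
    where
    bound : (a : Fin (suc k)) → toℕ a ≤ k
    bound a = s≤s⁻¹ (toℕ<n a)
    closed : ∀ {u w} → OnPath k f u → A u w → OnPath k f w
    closed (i , i≤k , refl) a = let (j , j≤k , e , _) = neighbour i≤k a in j , j≤k , sym e
    forward : ∀ a b → A (f (toℕ a)) (f (toℕ b)) → R (toℕ a) (toℕ b)
    forward a b x with neighbour (bound a) x
    ... | j , j≤k , e , r with injective p (bound b) j≤k e
    ...   | refl = r

  cycle-edge : ∀ {k f} → SimplePath k f → A (f k) (f 0) →
    ∀ {i j} → i ≤ k → j ≤ k → CycleRel (suc k) i j → A (f i) (f j)
  cycle-edge {k} {f} p closing = edge
    where
    next-edge : ∀ {i j} → j ≤ k → NextRel (suc k) i j → A (f i) (f j)
    next-edge j≤k (inj₁ refl) = linked p j≤k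
    next-edge j≤k (inj₂ (refl , refl)) = closing
    edge : ∀ {i j} → i ≤ k → j ≤ k → CycleRel (suc k) i j → A (f i) (f j)
    edge i≤k j≤k (inj₁ n) = next-edge j≤k n
    edge i≤k j≤k (inj₂ n) = A-sym (next-edge i≤k n)

  path-edge : ∀ {k f} → SimplePath k f → ∀ {i j} → i ≤ k → j ≤ k → PathRel i j → A (f i) (f j)
  path-edge p i≤k j≤k (inj₁ refl) = linked p j≤k
  path-edge p i≤k j≤k (inj₂ refl) = A-sym (linked p i≤k)

  cycle-iso : ∀ {k f} → SimplePath k f → 2 ≤ k → A (f k) (f 0) → (∀ v → Reach Γ (f 0) v) →
    IsCycle Γ
  cycle-iso {k} p 2≤k closing reach = suc k , s≤s 2≤k ,
    spanning-iso (CycleRel (suc k)) p (cycle-neighbour p 2≤k closing) (cycle-edge p closing) reach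

  -- A stuck walk ends at a vertex of degree at most one; a second walk from there
  -- either closes a cycle or is a spanning path.
  connected⇒cycle⊎path : W → (∀ u v → Reach Γ u v) → IsCycle Γ ⊎ IsPath Γ
  connected⇒cycle⊎path x connected with walk x
  ... | cycle k f 2≤k _ p closing = inj₁ (cycle-iso p 2≤k closing (connected (f 0)))
  ... | path k f _ _ st with walk (f k)
  ...   | cycle k' g 2≤k' _ p' closing = inj₁ (cycle-iso p' 2≤k' closing (connected (g 0)))
  ...   | path k' g g0≡end p' st' = inj₂ (suc k' , s≤s z≤n ,
          spanning-iso PathRel p' (path-neighbour p' start-end st') (path-edge p') (connected (g 0)))
    where
    start-end : ∀ {y z} → A (g 0) y → A (g 0) z → y ≡ z
    start-end = subst (λ s → ∀ {y z} → A s y → A s z → y ≡ z) (sym g0≡end) (stuck-end st)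

-- Read on wedges (v; p, q): the other wedge changes the far end, swaps near and
-- far end, or has apex p and near end v.
Neighbour : {X : Set} → X × X × X → X × X × X → Set
Neighbour (v , p , q) (v' , p' , q') =
  (v' ≡ v × p' ≡ p × q' ≢ q) ⊎ (v' ≡ v × p' ≡ q × q' ≡ p) ⊎ (v' ≡ p × p' ≡ v)

Neighbour-sym : {X : Set} {s s' : X × X × X} → Neighbour s s' → Neighbour s' s
Neighbour-sym (inj₁ (refl , refl , q'≢q)) = inj₁ (refl , refl , ≢-sym q'≢q)
Neighbour-sym (inj₂ (inj₁ (refl , refl , refl))) = inj₂ (inj₁ (refl , refl , refl))
Neighbour-sym (inj₂ (inj₂ (refl , refl))) = inj₂ (inj₂ (refl , refl))

neighbour? : {X : Set} → DecidableEquality X → ∀ s s' → Dec (Neighbour {X} s s')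
neighbour? _≟_ (v , p , q) (v' , p' , q') =
  (v' ≟ v ×-dec p' ≟ p ×-dec ¬? (q' ≟ q)) ⊎-dec
  (v' ≟ v ×-dec p' ≟ q ×-dec q' ≟ p) ⊎-dec (v' ≟ p ×-dec p' ≟ v)

map₃ : {X Y : Set} → (X → Y) → X × X × X → Y × Y × Y
map₃ f (x , y , z) = f x , f y , f z

Neighbour-map : {X Y : Set} (f : X → Y) → (∀ {x y} → f x ≡ f y → x ≡ y) →
  ∀ s s' → Neighbour (map₃ f s) (map₃ f s') ⟺ Neighbour s s'
Neighbour-map f f-inj (v , p , q) (v' , p' , q') = forward , backward
  where
  forward : Neighbour (map₃ f (v , p , q)) (map₃ f (v' , p' , q')) → Neighbour (v , p , q) (v' , p' , q')
  forward (inj₁ (e₁ , e₂ , ne)) = inj₁ (f-inj e₁ , f-inj e₂ , λ e → ne (cong f e))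
  forward (inj₂ (inj₁ (e₁ , e₂ , e₃))) = inj₂ (inj₁ (f-inj e₁ , f-inj e₂ , f-inj e₃))
  forward (inj₂ (inj₂ (e₁ , e₂))) = inj₂ (inj₂ (f-inj e₁ , f-inj e₂))
  backward : Neighbour (v , p , q) (v' , p' , q') → Neighbour (map₃ f (v , p , q)) (map₃ f (v' , p' , q'))
  backward (inj₁ (refl , refl , ne)) = inj₁ (refl , refl , λ e → ne (f-inj e))
  backward (inj₂ (inj₁ (refl , refl , refl))) = inj₂ (inj₁ (refl , refl , refl))
  backward (inj₂ (inj₂ (refl , refl))) = inj₂ (inj₂ (refl , refl))

-- A labelled (6,1)-necklace

_⟺-dec_ : ∀ {P Q : Set} → Dec P → Dec Q → Dec (P ⟺ Q)
p? ⟺-dec q? = (p? →-dec q?) ×-dec (q? →-dec p?)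

next? : ∀ n (i j : Fin n) → Dec (Next n i j)
next? n i j = (suc (toℕ i) ≟ℕ toℕ j) ⊎-dec (suc (toℕ i) ≟ℕ n ×-dec toℕ j ≟ℕ 0)

cycleAdj? : ∀ n (i j : Fin n) → Dec (CycleAdj n i j)
cycleAdj? n i j = next? n i j ⊎-dec next? n j i

-- Labels 0, 1, 2, 3 stand for the claw centre v and its leaves a, b, c; the i-th
-- cycle wedge has apex v and near and far end given by cycleLabel i.
cycleLabel : Fin 6 → Fin 4 × Fin 4
cycleLabel 0F = 1F , 2F
cycleLabel 1F = 1F , 3F
cycleLabel 2F = 3F , 1F
cycleLabel 3F = 3F , 2F
cycleLabel 4F = 2F , 3F
cycleLabel 5F = 2F , 1F

nearLabel farLabel : Fin 6 → Fin 4
nearLabel i = proj₁ (cycleLabel i)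
farLabel i = proj₂ (cycleLabel i)

cycleCorners : Fin 6 → Fin 4 × Fin 4 × Fin 4
cycleCorners i = 0F , cycleLabel i

_≟²_ : DecidableEquality (Fin 4 × Fin 4)
_≟²_ = ≡-dec _≟ᶠ_ _≟ᶠ_

cycleCorners-cycle : ∀ i j → Neighbour (cycleCorners i) (cycleCorners j) ⟺ CycleAdj 6 i j
cycleCorners-cycle = toWitness {a? = all? λ i → all? λ j →
  neighbour? _≟ᶠ_ (cycleCorners i) (cycleCorners j) ⟺-dec cycleAdj? 6 i j} _

cycleLabel-injective : ∀ i j → cycleLabel i ≡ cycleLabel j → i ≡ j
cycleLabel-injective = toWitness {a? = all? λ i → all? λ j → (cycleLabel i ≟² cycleLabel j) →-dec (i ≟ᶠ j)} _

nearLabel≢0 : ∀ i → nearLabel i ≢ 0F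
nearLabel≢0 = toWitness {a? = all? λ i → ¬? (nearLabel i ≟ᶠ 0F)} _

farLabel≢0 : ∀ i → farLabel i ≢ 0F
farLabel≢0 = toWitness {a? = all? λ i → ¬? (farLabel i ≟ᶠ 0F)} _

nearLabel≢farLabel : ∀ i → nearLabel i ≢ farLabel i
nearLabel≢farLabel = toWitness {a? = all? λ i → ¬? (nearLabel i ≟ᶠ farLabel i)} _

cycleLabel-swap : ∀ i → ∃[ j ] cycleLabel j ≡ (farLabel i , nearLabel i)
cycleLabel-swap = toWitness {a? = all? λ i → any? λ j → cycleLabel j ≟² (farLabel i , nearLabel i)} _

cycleLabel-attached : ∀ i → (nearLabel i ≡ 1F) ⟺ (toℕ i ≡ 0 ⊎ toℕ i ≡ 1)
cycleLabel-attached = toWitness {a? = all? λ i →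
  (nearLabel i ≟ᶠ 1F) ⟺-dec (toℕ i ≟ℕ 0 ⊎-dec toℕ i ≟ℕ 1)} _

cycleLabel-spread : ∀ i j k → Next 6 i j → Next 6 j k → nearLabel i ≢ nearLabel k
cycleLabel-spread = toWitness {a? = all? λ i → all? λ j → all? λ k →
  next? 6 i j →-dec (next? 6 j k →-dec ¬? (nearLabel i ≟ᶠ nearLabel k))} _

module BurgeonBicliques (H : SimpleGraph) where
  open SimpleGraph H renaming (n to N; sym to adj-sym)

  Vertex : Set
  Vertex = Fin N

  E : Vertex → Vertex → Set
  E i j = T (adj i j)

  E? : ∀ i j → Dec (E i j)
  E? i j = T? (adj i j)

  E-sym : ∀ {i j} → E i j → E j i
  E-sym {i} {j} = subst T (adj-sym i j)

  E⇒≢ : ∀ {i j} → E i j → i ≢ j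
  E⇒≢ {i} e refl = subst T (irrefl i) e

  Arc : Set
  Arc = Vertex × Vertex

  _≟ₐ_ : DecidableEquality Arc
  _≟ₐ_ = ≡-dec _≟ᶠ_ _≟ᶠ_

  DartAdj : Arc → Arc → Set
  DartAdj (u , w) (u' , w') = (u ≡ u' × w ≢ w') ⊎ (u ≡ w' × w ≡ u')

  G : Graph
  G = Burgeon H

  D : Set
  D = Dart H

  arc : D → Arc
  arc = proj₁

  dart : ∀ {x y} → E x y → D
  dart {x} {y} e = (x , y) , e

  dart-ext : ∀ {d d' : D} → arc d ≡ arc d' → d ≡ d'
  dart-ext {x , e} {.x , e'} refl = cong (x ,_) (T-irrelevant e e')

  _≟ᵈ_ : DecidableEquality D
  d ≟ᵈ d' = map′ dart-ext (cong arc) (arc d ≟ₐ arc d')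

  search-dart : (P : D → Set) → (∀ d → Dec (P d)) → Dec (∃ P)
  search-dart P P? = map′ (λ (i , j , e , p) → ((i , j) , e) , p)
                          (λ (((i , j) , e) , p) → i , j , e , p)
                          (any? λ i → any? λ j → at i j)
    where
    at : ∀ i j → Dec (Σ (E i j) λ e → P ((i , j) , e))
    at i j with E? i j
    ... | no ¬e = no λ (e , _) → ¬e e
    ... | yes e = map′ (e ,_) (λ (e' , p) → subst (λ z → P ((i , j) , z)) (T-irrelevant e' e) p)
                       (P? ((i , j) , e))

  -- Wedges and their bicliques

  record Wedge : Set where
    constructor wedge
    field
      apex near far : Vertex
      .near-adjacent : E apex near
      .far-adjacent  : E apex far
      .distinct      : near ≢ far
  open Wedge

  apex~near : (w : Wedge) → E (apex w) (near w)
  apex~near (wedge v p _ vp _ _) = recompute (E? v p) vp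

  apex~far : (w : Wedge) → E (apex w) (far w)
  apex~far (wedge v _ q _ vq _) = recompute (E? v q) vq

  near≢far : (w : Wedge) → near w ≢ far w
  near≢far (wedge _ _ _ _ _ p≢q) e = ⊥-elim-irr (p≢q e)

  apex≢near : (w : Wedge) → apex w ≢ near w
  apex≢near w = E⇒≢ (apex~near w)

  apex≢far : (w : Wedge) → apex w ≢ far w
  apex≢far w = E⇒≢ (apex~far w)

  corners : Wedge → Vertex × Vertex × Vertex
  corners w = apex w , near w , far w

  corners-injective : ∀ {w w'} → corners w ≡ corners w' → w ≡ w'
  corners-injective refl = refl

  _≟ᵂ_ : DecidableEquality Wedge
  w ≟ᵂ w' = map′ corners-injective (cong corners) (corners w ≟₃ corners w')
    where _≟₃_ = ≡-dec _≟ᶠ_ (≡-dec _≟ᶠ_ _≟ᶠ_)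

  search-wedge : (P : Wedge → Set) → (∀ w → Dec (P w)) → Dec (∃ P)
  search-wedge P P? = map′ (λ (v , p , q , vp , vq , p≢q , x) → wedge v p q vp vq p≢q , x)
                           (λ (w , x) → apex w , near w , far w , apex~near w , apex~far w , near≢far w , x)
                           (any? λ v → any? λ p → any? λ q → at v p q)
    where
    at : ∀ v p q → Dec (Σ (E v p) λ vp → Σ (E v q) λ vq → Σ (p ≢ q) λ p≢q → P (wedge v p q vp vq p≢q))
    at v p q with E? v p | E? v q | p ≟ᶠ q
    ... | no ¬vp | _ | _ = no λ (vp , _) → ¬vp vp
    ... | yes _ | no ¬vq | _ = no λ (_ , vq , _) → ¬vq vq
    ... | yes _ | yes _ | yes p≡q = no λ (_ , _ , p≢q , _) → p≢q p≡q
    ... | yes vp | yes vq | no p≢q =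
          map′ (λ x → vp , vq , p≢q , x) (λ (_ , _ , _ , x) → x) (P? (wedge v p q vp vq p≢q))

  wedge? : Dec Wedge
  wedge? = map′ proj₁ (_, tt) (search-wedge (λ _ → ⊤) (λ _ → yes tt))

  code : Wedge → Fin (N * (N * N))
  code w = combine (apex w) (combine (near w) (far w))

  code-injective : ∀ {w w'} → code w ≡ code w' → w ≡ w'
  code-injective {w} {w'} e with combine-injective (apex w) _ (apex w') _ e
  ... | refl , e' with combine-injective (near w) (far w) (near w') (far w') e'
  ...   | refl , refl = refl

  -- The biclique of a wedge is the induced path twin – centre – leaf of B(H).
  data _∈ᵂ_ : Arc → Wedge → Set where
    twin   : ∀ {w} → (near w , apex w) ∈ᵂ w
    centre : ∀ {w} → (apex w , near w) ∈ᵂ w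
    leaf   : ∀ {w} → (apex w , far w) ∈ᵂ w

  _∈ᵂ?_ : ∀ x w → Dec (x ∈ᵂ w)
  x ∈ᵂ? w with x ≟ₐ (near w , apex w) | x ≟ₐ (apex w , near w) | x ≟ₐ (apex w , far w)
  ... | yes refl | _ | _ = yes twin
  ... | no _ | yes refl | _ = yes centre
  ... | no _ | no _ | yes refl = yes leaf
  ... | no ¬t | no ¬c | no ¬l = no λ { twin → ¬t refl ; centre → ¬c refl ; leaf → ¬l refl }

  bicliqueSet : Wedge → Subset G
  bicliqueSet w d = does (arc d ∈ᵂ? w)

  ∈bicliqueSet⇒ : ∀ {w d} → _∈_ {G} d (bicliqueSet w) → arc d ∈ᵂ w
  ∈bicliqueSet⇒ {w} {d} = does-true (arc d ∈ᵂ? w)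

  ∈bicliqueSet⇐ : ∀ {w d} → arc d ∈ᵂ w → _∈_ {G} d (bicliqueSet w)
  ∈bicliqueSet⇐ {w} {d} = dec-true (arc d ∈ᵂ? w)

  DartAdj-sym : ∀ {x y} → DartAdj x y → DartAdj y x
  DartAdj-sym (inj₁ (refl , w≢w')) = inj₁ (refl , ≢-sym w≢w')
  DartAdj-sym (inj₂ (refl , refl)) = inj₂ (refl , refl)

  DartAdj-irrefl : ∀ {u w} → u ≢ w → ¬ DartAdj (u , w) (u , w)
  DartAdj-irrefl _ (inj₁ (_ , w≢w)) = w≢w refl
  DartAdj-irrefl u≢w (inj₂ (u≡w , _)) = u≢w u≡w

  twin≁leaf : ∀ w → ¬ DartAdj (near w , apex w) (apex w , far w)
  twin≁leaf w (inj₁ (p≡v , _)) = apex≢near w (sym p≡v)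
  twin≁leaf w (inj₂ (p≡q , _)) = near≢far w p≡q

  twin-leaf-neighbour : ∀ {a b} w → DartAdj (a , b) (near w , apex w) → DartAdj (a , b) (apex w , far w) →
    (a , b) ≡ (apex w , near w)
  twin-leaf-neighbour w (inj₁ (refl , _)) (inj₁ (p≡v , _)) = ⊥-elim (apex≢near w (sym p≡v))
  twin-leaf-neighbour w (inj₁ (refl , _)) (inj₂ (p≡q , _)) = ⊥-elim (near≢far w p≡q)
  twin-leaf-neighbour w (inj₂ (refl , refl)) _ = refl

  centre-neighbour : ∀ {a b} w → DartAdj (a , b) (apex w , near w) → ¬ DartAdj (a , b) (apex w , far w) →
    (a , b) ≡ (near w , apex w) ⊎ (a , b) ≡ (apex w , far w)
  centre-neighbour w (inj₂ (refl , refl)) _ = inj₁ refl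
  centre-neighbour {b = b} w (inj₁ (refl , _)) ≁leaf with b ≟ᶠ far w
  ... | yes refl = inj₂ refl
  ... | no b≢q = ⊥-elim (≁leaf (inj₁ (refl , b≢q)))

  ⟺-absent : ∀ {P : Set} {b : Bool} → ¬ P → P ⟺ (b ≢ b)
  ⟺-absent ¬p = (λ p → ⊥-elim (¬p p)) , (λ b≢b → ⊥-elim (b≢b refl))

  ⟺-present : ∀ {P : Set} {b b' : Bool} → P → b ≢ b' → P ⟺ (b ≢ b')
  ⟺-present p b≢b' = (λ _ → b≢b') , (λ _ → p)

  isCentre : Wedge → Arc → Bool
  isCentre w x = does (x ≟ₐ (apex w , near w))

  centreRole : ∀ {x w} → x ∈ᵂ w → Bool
  centreRole centre = true
  centreRole twin   = false
  centreRole leaf   = false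

  isCentre-role : ∀ {x w} (m : x ∈ᵂ w) → isCentre w x ≡ centreRole m
  isCentre-role {w = w} twin =
    dec-false ((near w , apex w) ≟ₐ (apex w , near w)) λ e → apex≢near w (sym (cong proj₁ e))
  isCentre-role {w = w} centre = dec-true ((apex w , near w) ≟ₐ (apex w , near w)) refl
  isCentre-role {w = w} leaf =
    dec-false ((apex w , far w) ≟ₐ (apex w , near w)) λ e → near≢far w (sym (cong proj₂ e))

  role-adjacency : ∀ {w x y} (mx : x ∈ᵂ w) (my : y ∈ᵂ w) →
    DartAdj x y ⟺ (centreRole mx ≢ centreRole my)
  role-adjacency {w} twin   twin   = ⟺-absent (DartAdj-irrefl (≢-sym (apex≢near w)))
  role-adjacency {w} twin   centre = ⟺-present (inj₂ (refl , refl)) λ ()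
  role-adjacency {w} twin   leaf   = ⟺-absent (twin≁leaf w)
  role-adjacency {w} centre twin   = ⟺-present (inj₂ (refl , refl)) λ ()
  role-adjacency {w} centre centre = ⟺-absent (DartAdj-irrefl (apex≢near w))
  role-adjacency {w} centre leaf   = ⟺-present (inj₁ (refl , near≢far w)) λ ()
  role-adjacency {w} leaf   twin   = ⟺-absent (λ a → twin≁leaf w (DartAdj-sym a))
  role-adjacency {w} leaf   centre = ⟺-present (inj₁ (refl , ≢-sym (near≢far w))) λ ()
  role-adjacency {w} leaf   leaf   = ⟺-absent (DartAdj-irrefl (apex≢far w))

  wedge-completeBipartite : ∀ w → IsCompleteBipartite G (bicliqueSet w)
  wedge-completeBipartite w =
    (λ d → isCentre w (arc d)) ,
    (dart (apex~near w) , ∈bicliqueSet⇐ {w} {dart (apex~near w)} centre , isCentre-role {w = w} centre) ,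
    (dart (E-sym (apex~near w)) , ∈bicliqueSet⇐ {w} {dart (E-sym (apex~near w))} twin , isCentre-role {w = w} twin) ,
    λ u v u∈ v∈ → let mu = ∈bicliqueSet⇒ {w} {u} u∈ ; mv = ∈bicliqueSet⇒ {w} {v} v∈ in
      subst₂ (λ b b' → DartAdj (arc u) (arc v) ⟺ (b ≢ b'))
             (sym (isCentre-role mu)) (sym (isCentre-role mv)) (role-adjacency mu mv)

  -- Twin and leaf lie on the side opposite the centre. A dart on the centre's side
  -- is adjacent to twin and leaf, so it is the centre; a dart on the other side is
  -- adjacent to the centre but not to the leaf, so it is the twin or the leaf.
  wedge-maximal : ∀ w (S : Subset G) → IsCompleteBipartite G S →
    _⊆_ {G} (bicliqueSet w) S → _⊆_ {G} S (bicliqueSet w)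
  wedge-maximal w S (side , _ , _ , adj⟺) sub z z∈S = ∈bicliqueSet⇐ {w} {z} (role (side z ≟ᵇ side c))
    where
    c t l : D
    c = dart (apex~near w)
    t = dart (E-sym (apex~near w))
    l = dart (apex~far w)
    c∈S = sub c (∈bicliqueSet⇐ {w} {c} centre)
    t∈S = sub t (∈bicliqueSet⇐ {w} {t} twin)
    l∈S = sub l (∈bicliqueSet⇐ {w} {l} leaf)
    adjacent : ∀ {x y} → _∈_ {G} x S → _∈_ {G} y S → side x ≢ side y → DartAdj (arc x) (arc y)
    adjacent x∈ y∈ = proj₂ (adj⟺ _ _ x∈ y∈)
    separated : ∀ {x y} → _∈_ {G} x S → _∈_ {G} y S → DartAdj (arc x) (arc y) → side x ≢ side y
    separated x∈ y∈ = proj₁ (adj⟺ _ _ x∈ y∈)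
    c≢t = separated c∈S t∈S (inj₂ (refl , refl))
    c≢l = separated c∈S l∈S (inj₁ (refl , near≢far w))
    role : Dec (side z ≡ side c) → arc z ∈ᵂ w
    role (yes z≡c) = subst (_∈ᵂ w) (sym (twin-leaf-neighbour w
      (adjacent z∈S t∈S λ e → c≢t (trans (sym z≡c) e))
      (adjacent z∈S l∈S λ e → c≢l (trans (sym z≡c) e)))) centre
    role (no z≢c) with centre-neighbour w (adjacent z∈S c∈S z≢c)
      (λ a → separated z∈S l∈S a (trans (¬-not z≢c) (sym (¬-not (≢-sym c≢l)))))
    ... | inj₁ e = subst (_∈ᵂ w) (sym e) twin
    ... | inj₂ e = subst (_∈ᵂ w) (sym e) leaf

  wedge-biclique : ∀ w → IsBiclique G (bicliqueSet w)
  wedge-biclique w = wedge-completeBipartite w , λ S cb sub → wedge-maximal w S cb sub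

  KG : Graph
  KG = KBe G

  bicliqueOf : Wedge → V KG
  bicliqueOf w = bicliqueSet w , wedge-biclique w

  infix 4 _~_
  _~_ : Wedge → Wedge → Set
  w ~ w' = Neighbour (corners w) (corners w')

  roles-determine : ∀ w {w'} → (apex w , near w) ∈ᵂ w' → (near w , apex w) ∈ᵂ w' →
    (apex w , far w) ∈ᵂ w' → w ≡ w'
  roles-determine w centre _ twin = ⊥-elim (apex≢near w refl)
  roles-determine w centre _ centre = ⊥-elim (near≢far w refl)
  roles-determine w centre _ leaf = refl
  roles-determine w twin _ twin = ⊥-elim (near≢far w refl)
  roles-determine w twin _ centre = ⊥-elim (apex≢near w refl)
  roles-determine w twin _ leaf = ⊥-elim (apex≢near w refl)
  roles-determine w {w'} leaf twin _ = ⊥-elim (near≢far w' refl)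
  roles-determine w leaf centre _ = ⊥-elim (apex≢near w refl)
  roles-determine w leaf leaf _ = ⊥-elim (apex≢near w refl)

  role-dart : ∀ {x w} → x ∈ᵂ w → Σ D λ d → arc d ≡ x
  role-dart {w = w} twin   = dart (E-sym (apex~near w)) , refl
  role-dart {w = w} centre = dart (apex~near w) , refl
  role-dart {w = w} leaf   = dart (apex~far w) , refl

  bicliqueSet-injective : ∀ {w w'} → (∀ d → bicliqueSet w d ≡ bicliqueSet w' d) → w ≡ w'
  bicliqueSet-injective {w} {w'} same = roles-determine w (moved centre) (moved twin) (moved leaf)
    where
    moved : ∀ {x} → x ∈ᵂ w → x ∈ᵂ w'
    moved m with role-dart m
    ... | d , refl = ∈bicliqueSet⇒ {w'} {d} (trans (sym (same d)) (∈bicliqueSet⇐ {w} {d} m))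

  ~-irrefl : ∀ {w} → ¬ w ~ w
  ~-irrefl (inj₁ (_ , _ , q≢q)) = q≢q refl
  ~-irrefl {w} (inj₂ (inj₁ (_ , p≡q , _))) = near≢far w p≡q
  ~-irrefl {w} (inj₂ (inj₂ (v≡p , _))) = apex≢near w v≡p

  edge-at-centre : ∀ {w x y} → x ∈ᵂ w → y ∈ᵂ w → DartAdj x y →
    x ≡ (apex w , near w) ⊎ y ≡ (apex w , near w)
  edge-at-centre centre _ _ = inj₁ refl
  edge-at-centre _ centre _ = inj₂ refl
  edge-at-centre {w} twin twin a = ⊥-elim (DartAdj-irrefl (≢-sym (apex≢near w)) a)
  edge-at-centre {w} twin leaf a = ⊥-elim (twin≁leaf w a)
  edge-at-centre {w} leaf twin a = ⊥-elim (twin≁leaf w (DartAdj-sym a))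
  edge-at-centre {w} leaf leaf a = ⊥-elim (DartAdj-irrefl (apex≢far w) a)

  -- Only when the centre of w is the leaf of w' does the second dart of the
  -- shared edge matter: it must then be the leaf of w and the centre of w'.
  shared-centre-edge : ∀ w w' {y} → w ≢ w' → (apex w , near w) ∈ᵂ w' → y ∈ᵂ w → y ∈ᵂ w' →
    DartAdj (apex w , near w) y → w ~ w'
  shared-centre-edge w w' w≢w' centre _ _ _ =
    inj₁ (refl , refl , λ q'≡q → w≢w' (corners-injective (cong (λ r → apex w , near w , r) (sym q'≡q))))
  shared-centre-edge w w' _ twin _ _ _ = inj₂ (inj₂ (refl , refl))
  shared-centre-edge w w' _ leaf twin twin _ = ⊥-elim (near≢far w' refl)
  shared-centre-edge w w' _ leaf twin centre _ = ⊥-elim (apex≢near w refl)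
  shared-centre-edge w w' _ leaf twin leaf _ = ⊥-elim (apex≢near w refl)
  shared-centre-edge w w' _ leaf centre _ a = ⊥-elim (DartAdj-irrefl (apex≢near w) a)
  shared-centre-edge w w' _ leaf leaf twin _ = ⊥-elim (apex≢far w refl)
  shared-centre-edge w w' _ leaf leaf centre _ = inj₂ (inj₁ (refl , refl , refl))
  shared-centre-edge w w' _ leaf leaf leaf _ = ⊥-elim (near≢far w refl)

  adjacent⇒~ : ∀ {w w'} → Adj KG (bicliqueOf w) (bicliqueOf w') → w ~ w'
  adjacent⇒~ {w} {w'} (distinct , x , y , x∈w , y∈w , x∈w' , y∈w' , x~y)
    with ∈bicliqueSet⇒ {w} {x} x∈w | ∈bicliqueSet⇒ {w} {y} y∈w
       | ∈bicliqueSet⇒ {w'} {x} x∈w' | ∈bicliqueSet⇒ {w'} {y} y∈w'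
  ... | mx | my | mx' | my' with edge-at-centre mx my x~y
  ...   | inj₁ refl = shared-centre-edge w w' w≢w' mx' my my' x~y
    where w≢w' = λ e → distinct λ d → cong (λ u → bicliqueSet u d) e
  ...   | inj₂ refl = shared-centre-edge w w' w≢w' my' mx mx' (DartAdj-sym x~y)
    where w≢w' = λ e → distinct λ d → cong (λ u → bicliqueSet u d) e

  SharedEdge : Wedge → Wedge → Set
  SharedEdge w w' = ∃[ x ] ∃[ y ] (_∈_ {G} x (bicliqueSet w) × _∈_ {G} y (bicliqueSet w) ×
                                   _∈_ {G} x (bicliqueSet w') × _∈_ {G} y (bicliqueSet w') × Adj G x y)

  sharedEdge : ∀ {w w' x y} → x ∈ᵂ w → y ∈ᵂ w → x ∈ᵂ w' → y ∈ᵂ w' → DartAdj x y → SharedEdge w w'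
  sharedEdge {w} {w'} mx my mx' my' x~y with role-dart mx | role-dart my
  ... | d , refl | e , refl =
    d , e , ∈bicliqueSet⇐ {w} {d} mx , ∈bicliqueSet⇐ {w} {e} my ,
    ∈bicliqueSet⇐ {w'} {d} mx' , ∈bicliqueSet⇐ {w'} {e} my' , x~y

  ~⇒adjacent : ∀ {w w'} → w ~ w' → Adj KG (bicliqueOf w) (bicliqueOf w')
  ~⇒adjacent {w} {w'} w~w' =
    (λ same → ~-irrefl {w} (subst (w ~_) (sym (bicliqueSet-injective same)) w~w')) , shared w' w~w'
    where
    shared : ∀ w' → w ~ w' → SharedEdge w w'
    shared _ (inj₁ (refl , refl , _)) = sharedEdge centre twin centre twin (inj₂ (refl , refl))
    shared _ (inj₂ (inj₁ (refl , refl , refl))) = sharedEdge centre leaf leaf centre (inj₁ (refl , near≢far w))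
    shared _ (inj₂ (inj₂ (refl , refl))) = sharedEdge centre twin twin centre (inj₂ (refl , refl))

  ~-sym : ∀ {w w'} → w ~ w' → w' ~ w
  ~-sym = Neighbour-sym

  swapped : Wedge → Wedge
  swapped (wedge v p q vp vq p≢q) = wedge v q p vq vp (≢-sym p≢q)

  ~swapped : ∀ w → w ~ swapped w
  ~swapped w = inj₂ (inj₁ (refl , refl , refl))

  _∋ᵃ_ : Subset G → Arc → Set
  S ∋ᵃ x = Σ D λ d → _∈_ {G} d S × arc d ≡ x

  member : ∀ {S d} → S ∋ᵃ arc d → _∈_ {G} d S
  member {S} (d' , d'∈S , e) = subst (λ z → _∈_ {G} z S) (dart-ext e) d'∈S

  wedge⊆ : ∀ w S → S ∋ᵃ (near w , apex w) → S ∋ᵃ (apex w , near w) → S ∋ᵃ (apex w , far w) →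
    _⊆_ {G} (bicliqueSet w) S
  wedge⊆ w S t c l d d∈ with ∈bicliqueSet⇒ {w} {d} d∈
  ... | twin   = member {S} {d} t
  ... | centre = member {S} {d} c
  ... | leaf   = member {S} {d} l

  ⊆-antisym : ∀ (S S' : Subset G) → _⊆_ {G} S S' → _⊆_ {G} S' S → ∀ d → S d ≡ S' d
  ⊆-antisym S S' S⊆S' S'⊆S d with S d in eq | S' d in eq'
  ... | true  | true  = refl
  ... | false | false = refl
  ... | true  | false = trans (sym (S⊆S' d eq)) eq'
  ... | false | true  = trans (sym eq) (S'⊆S d eq')

  induced-path-wedge : ∀ (a b c : D) → DartAdj (arc a) (arc b) → DartAdj (arc b) (arc c) →
    ¬ DartAdj (arc a) (arc c) → arc a ≢ arc c →
    ∃[ w ] (arc b ≡ (apex w , near w) ×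
            ((arc a ≡ (near w , apex w) × arc c ≡ (apex w , far w)) ⊎
             (arc a ≡ (apex w , far w) × arc c ≡ (near w , apex w))))
  induced-path-wedge ((_ , a₂) , _) _ ((_ , c₂) , _) (inj₁ (refl , _)) (inj₁ (refl , _)) a≁c a≢c
    with a₂ ≟ᶠ c₂
  ... | yes refl = ⊥-elim (a≢c refl)
  ... | no a₂≢c₂ = ⊥-elim (a≁c (inj₁ (refl , a₂≢c₂)))
  induced-path-wedge (_ , va) (_ , vp) _ (inj₁ (refl , a≢p)) (inj₂ (refl , refl)) _ _ =
    wedge _ _ _ vp va (≢-sym a≢p) , refl , inj₂ (refl , refl)
  induced-path-wedge _ (_ , vp) (_ , vc) (inj₂ (refl , refl)) (inj₁ (refl , p≢c)) _ _ =
    wedge _ _ _ vp vc p≢c , refl , inj₁ (refl , refl)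
  induced-path-wedge _ _ _ (inj₂ (refl , refl)) (inj₂ (refl , refl)) _ a≢c = ⊥-elim (a≢c refl)

  OnEdge : Vertex → Vertex → D → Set
  OnEdge v p d = arc d ≡ (v , p) ⊎ arc d ≡ (p , v)

  isolated-edge-component : ∀ {v p} (vp : E v p) → (∀ {q} → E v q → q ≡ p) → (∀ {r} → E p r → r ≡ v) →
    ∀ {d} → Reach G (dart vp) d → OnEdge v p d
  isolated-edge-component {v} {p} vp only-p only-v r =
    reach-closed G (OnEdge v p) (λ {d} {e} → closed {d} {e}) r (inj₁ refl)
    where
    closed : ∀ {d e} → OnEdge v p d → Adj G d e → OnEdge v p e
    closed {_} {(_ , y) , e} (inj₁ refl) (inj₁ (refl , p≢y)) = ⊥-elim (p≢y (sym (only-p e)))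
    closed (inj₁ refl) (inj₂ (refl , refl)) = inj₂ refl
    closed {_} {(_ , y) , e} (inj₂ refl) (inj₁ (refl , v≢y)) = ⊥-elim (v≢y (sym (only-v e)))
    closed (inj₂ refl) (inj₂ (refl , refl)) = inj₁ refl

  -- Classification of bicliques

  module Classification (w₀ : Wedge) (connected : ∀ u v → Reach G u v) where

    isolated-edge : ∀ {v p} → E v p → (∀ {q} → E v q → q ≡ p) → (∀ {r} → E p r → r ≡ v) → ⊥
    isolated-edge vp only-p only-v with isolated-edge-component vp only-p only-v
                                          (connected (dart vp) (dart (apex~near w₀)))
    ... | inj₁ refl = near≢far w₀ (trans (only-p (apex~near w₀)) (sym (only-p (apex~far w₀))))
    ... | inj₂ refl = near≢far w₀ (trans (only-v (apex~near w₀)) (sym (only-v (apex~far w₀))))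

    other-neighbour? : ∀ v p → Dec (∃[ q ] (E v q × q ≢ p))
    other-neighbour? v p = any? λ q → E? v q ×-dec ¬? (q ≟ᶠ p)

    no-other-neighbour : ∀ {v p} → ¬ (∃[ q ] (E v q × q ≢ p)) → ∀ {q} → E v q → q ≡ p
    no-other-neighbour {p = p} none {q} vq with q ≟ᶠ p
    ... | yes q≡p = q≡p
    ... | no q≢p = ⊥-elim (none (q , vq , q≢p))

    edge-in-wedge : ∀ (x y : D) → DartAdj (arc x) (arc y) → ∃[ w ] (arc x ∈ᵂ w × arc y ∈ᵂ w)
    edge-in-wedge (_ , vp) (_ , vq) (inj₁ (refl , p≢q)) = wedge _ _ _ vp vq p≢q , centre , leaf
    edge-in-wedge ((v , p) , vp) (_ , pv) (inj₂ (refl , refl))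
      with other-neighbour? v p | other-neighbour? p v
    ... | yes (q , vq , q≢p) | _ = wedge v p q vp vq (≢-sym q≢p) , centre , twin
    ... | no _ | yes (r , pr , r≢v) = wedge p v r pv pr (≢-sym r≢v) , twin , centre
    ... | no none | no none' = ⊥-elim (isolated-edge vp (no-other-neighbour none) (no-other-neighbour none'))

    -- A third dart of S forms an induced path with the two darts witnessing its
    -- sides; otherwise S is a single edge, which lies in a wedge as H is not just
    -- that edge.
    biclique⊆wedge : (S : V KG) → ∃[ w ] (_⊆_ {G} (proj₁ S) (bicliqueSet w))
    biclique⊆wedge (S , cb@(side , (x , x∈ , x-true) , (y , y∈ , y-false) , adj⟺) , _) =
      cases (search-dart (λ z → _∈_ {G} z S × z ≢ x × z ≢ y)
                         (λ z → (S z ≟ᵇ true) ×-dec ¬? (z ≟ᵈ x) ×-dec ¬? (z ≟ᵈ y)))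
      where
      InS : D → Set
      InS d = _∈_ {G} d S
      adjacent : ∀ {u v} → InS u → InS v → side u ≢ side v → DartAdj (arc u) (arc v)
      adjacent u∈ v∈ = proj₂ (adj⟺ _ _ u∈ v∈)
      separated : ∀ {u v} → InS u → InS v → side u ≡ side v → ¬ DartAdj (arc u) (arc v)
      separated u∈ v∈ same a = proj₁ (adj⟺ _ _ u∈ v∈) a same
      x≁y : side x ≢ side y
      x≁y e with trans (sym x-true) (trans e y-false)
      ... | ()
      induced-path : ∀ a b c → InS a → InS b → InS c → DartAdj (arc a) (arc b) → DartAdj (arc b) (arc c) →
        ¬ DartAdj (arc a) (arc c) → a ≢ c → ∃[ w ] (_⊆_ {G} S (bicliqueSet w))
      induced-path a b c a∈ b∈ c∈ ab bc a≁c a≢c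
        with induced-path-wedge a b c ab bc a≁c (λ e → a≢c (dart-ext e))
      ... | w , eb , inj₁ (ea , ec) =
        w , wedge-maximal w S cb (wedge⊆ w S (a , a∈ , ea) (b , b∈ , eb) (c , c∈ , ec))
      ... | w , eb , inj₂ (ea , ec) =
        w , wedge-maximal w S cb (wedge⊆ w S (c , c∈ , ec) (b , b∈ , eb) (a , a∈ , ea))
      cases : Dec (∃ λ z → InS z × z ≢ x × z ≢ y) → ∃[ w ] (_⊆_ {G} S (bicliqueSet w))
      cases (yes (z , z∈ , z≢x , z≢y)) with side z ≟ᵇ true
      ... | yes z-true = induced-path z y x z∈ y∈ x∈
            (adjacent z∈ y∈ λ e → x≁y (trans x-true (trans (sym z-true) e)))
            (adjacent y∈ x∈ (≢-sym x≁y)) (separated z∈ x∈ (trans z-true (sym x-true))) z≢x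
      ... | no z-false = induced-path z x y z∈ x∈ y∈
            (adjacent z∈ x∈ λ e → z-false (trans e x-true)) (adjacent x∈ y∈ x≁y)
            (separated z∈ y∈ (trans (¬-not z-false) (sym y-false))) z≢y
      cases (no no-third) with edge-in-wedge x y (adjacent x∈ y∈ x≁y)
      ... | w , mx , my = w , λ z z∈ → ∈bicliqueSet⇐ {w} {z} (role z z∈)
        where
        role : ∀ z → InS z → arc z ∈ᵂ w
        role z z∈ with z ≟ᵈ x | z ≟ᵈ y
        ... | yes refl | _ = mx
        ... | no _ | yes refl = my
        ... | no z≢x | no z≢y = ⊥-elim (no-third (z , z∈ , z≢x , z≢y))

    biclique≈wedge : (S : V KG) → ∃[ w ] _≈_ KG (bicliqueOf w) S
    biclique≈wedge S@(Sf , cb , maximal) with biclique⊆wedge S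
    ... | w , S⊆w =
      w , ⊆-antisym (bicliqueSet w) Sf (maximal (bicliqueSet w) (wedge-completeBipartite w) S⊆w) S⊆w

    Γ : Graph
    Γ = relGraph Wedge _~_

    same-apex-near : ∀ {w w'} → apex w ≡ apex w' → near w ≡ near w' → Reach Γ w w'
    same-apex-near {w} {w'} refl refl with far w ≟ᶠ far w'
    ... | yes refl = here
    ... | no q≢q' = step (inj₁ (refl , refl , ≢-sym q≢q')) here

    CentreOrTwin : Arc → Wedge → Set
    CentreOrTwin x w = x ≡ (apex w , near w) ⊎ x ≡ (near w , apex w)

    towards-centre : ∀ {x w} → x ∈ᵂ w → ∃[ w' ] (Reach Γ w w' × CentreOrTwin x w')
    towards-centre {w = w} twin   = w , here , inj₂ refl
    towards-centre {w = w} centre = w , here , inj₁ refl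
    towards-centre {w = w} leaf   = swapped w , step (~swapped w) here , inj₁ refl

    sharing-anchor : ∀ {x w w'} → CentreOrTwin x w → CentreOrTwin x w' → Reach Γ w w'
    sharing-anchor (inj₁ refl) (inj₁ e) = same-apex-near (cong proj₁ e) (cong proj₂ e)
    sharing-anchor (inj₁ refl) (inj₂ refl) = step (inj₂ (inj₂ (refl , refl))) here
    sharing-anchor (inj₂ refl) (inj₁ refl) = step (inj₂ (inj₂ (refl , refl))) here
    sharing-anchor (inj₂ refl) (inj₂ e) = same-apex-near (cong proj₂ e) (cong proj₁ e)

    sharing-dart : ∀ {x w w'} → x ∈ᵂ w → x ∈ᵂ w' → Reach Γ w w'
    sharing-dart m m' with towards-centre m | towards-centre m'
    ... | u , w⇝u , anchor | u' , w'⇝u' , anchor' =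
      reach-trans Γ w⇝u (reach-trans Γ (sharing-anchor anchor anchor')
                                       (reach-sym Γ (λ {u} {v} → ~-sym {u} {v}) w'⇝u'))

    -- Adjacent darts lie in a common wedge, and wedges sharing a dart are connected.
    wedges-connected : ∀ w w' → Reach Γ w w'
    wedges-connected w w' with reach-closed G Covered (λ {d} {e} → closed {d} {e})
                                 (connected (dart (apex~near w)) (dart (apex~near w'))) (w , centre , here)
      where
      Covered : D → Set
      Covered d = ∃[ u ] (arc d ∈ᵂ u × Reach Γ w u)
      closed : ∀ {d e} → Covered d → Adj G d e → Covered e
      closed {d} {e} (u , d∈u , w⇝u) d~e with edge-in-wedge d e d~e
      ... | u' , d∈u' , e∈u' = u' , e∈u' , reach-trans Γ w⇝u (sharing-dart d∈u d∈u')
    ... | u , m , w⇝u = reach-trans Γ w⇝u (sharing-dart m centre)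

  -- Without a wedge every vertex of H has degree at most one, so B(H) is the single
  -- edge between the darts of d₀, and these two darts form the only biclique.
  module WithoutWedge (no-wedge : ¬ Wedge) (d₀ : D) (connected : ∀ u v → Reach G u v) where

    v p : Vertex
    v = proj₁ (arc d₀)
    p = proj₂ (arc d₀)

    vp : E v p
    vp = proj₂ d₀

    unique-neighbour : ∀ {x q q'} → E x q → E x q' → q ≡ q'
    unique-neighbour {x} {q} {q'} xq xq' with q ≟ᶠ q'
    ... | yes q≡q' = q≡q'
    ... | no q≢q' = ⊥-elim (no-wedge (wedge x q q' xq xq' q≢q'))

    on-edge : ∀ d → OnEdge v p d
    on-edge d = isolated-edge-component vp (λ vq → unique-neighbour vq vp) (λ pr → unique-neighbour pr (E-sym vp))
                                         (connected d₀ d)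

    side : D → Bool
    side d = does (arc d ≟ₐ (v , p))

    side-vp : ∀ {d} → arc d ≡ (v , p) → side d ≡ true
    side-vp {d} = dec-true (arc d ≟ₐ (v , p))

    side-pv : ∀ {d} → arc d ≡ (p , v) → side d ≡ false
    side-pv {d} e = dec-false (arc d ≟ₐ (v , p)) λ e' → E⇒≢ vp (cong proj₁ (trans (sym e') e))

    data End : D → Bool → Set where
      tail : ∀ {d} → arc d ≡ (v , p) → End d true
      head : ∀ {d} → arc d ≡ (p , v) → End d false

    end : ∀ d → End d (side d)
    end d with on-edge d
    ... | inj₁ e = subst (End d) (sym (side-vp {d} e)) (tail e)
    ... | inj₂ e = subst (End d) (sym (side-pv {d} e)) (head e)

    edge-bipartite : ∀ d e → DartAdj (arc d) (arc e) ⟺ (side d ≢ side e)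
    edge-bipartite d e with side d | end d | side e | end e
    ... | _ | tail refl | _ | tail refl = ⟺-absent (DartAdj-irrefl (E⇒≢ vp))
    ... | _ | tail refl | _ | head refl = ⟺-present (inj₂ (refl , refl)) λ ()
    ... | _ | head refl | _ | tail refl = ⟺-present (inj₂ (refl , refl)) λ ()
    ... | _ | head refl | _ | head refl = ⟺-absent (DartAdj-irrefl (≢-sym (E⇒≢ vp)))

    everything : Subset G
    everything _ = true

    everything-biclique : IsBiclique G everything
    everything-biclique =
      (side , (d₀ , refl , side-vp {d₀} refl) , (dart (E-sym vp) , refl , side-pv {dart (E-sym vp)} refl) ,
       λ d e _ _ → edge-bipartite d e) ,
      λ _ _ _ _ _ → refl

    biclique-full : (S : V KG) → ∀ d → _∈_ {G} d (proj₁ S)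
    biclique-full (S , (side' , (x , x∈ , x-true) , (y , y∈ , y-false) , _) , _) d =
      position (on-edge d) (on-edge x) (on-edge y)
      where
      x≢y : arc x ≢ arc y
      x≢y e with trans (sym x-true) (trans (cong side' (dart-ext e)) y-false)
      ... | ()
      at : ∀ {z} → _∈_ {G} z S → arc z ≡ arc d → _∈_ {G} d S
      at z∈ e = subst (λ u → _∈_ {G} u S) (dart-ext e) z∈
      position : OnEdge v p d → OnEdge v p x → OnEdge v p y → _∈_ {G} d S
      position (inj₁ d≡) (inj₁ x≡) _ = at x∈ (trans x≡ (sym d≡))
      position (inj₂ d≡) (inj₂ x≡) _ = at x∈ (trans x≡ (sym d≡))
      position (inj₁ d≡) _ (inj₁ y≡) = at y∈ (trans y≡ (sym d≡))
      position (inj₂ d≡) _ (inj₂ y≡) = at y∈ (trans y≡ (sym d≡))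
      position (inj₁ _) (inj₂ x≡) (inj₂ y≡) = ⊥-elim (x≢y (trans x≡ (sym y≡)))
      position (inj₂ _) (inj₁ x≡) (inj₁ y≡) = ⊥-elim (x≢y (trans x≡ (sym y≡)))

    single-vertex-path : IsPath KG
    single-vertex-path = 1 , s≤s z≤n , (λ _ → everything , everything-biclique) ,
      ((λ { 0F 0F _ → refl }) ,
       (λ { 0F 0F → (λ (distinct , _) → ⊥-elim (distinct λ _ → refl)) , λ { (inj₁ ()) ; (inj₂ ()) } })) ,
      λ S → 0F , λ d → sym (biclique-full S d)

  -- Extended claws

  Extension : Vertex → Vertex → Vertex → Vertex → Set
  Extension v a b c = (∃[ d ] (E v d × d ≢ a × d ≢ b × d ≢ c)) ⊎ (∃[ e ] (E a e × e ≢ v))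

  ExtendedClaw : Set
  ExtendedClaw = ∃[ v ] ∃[ a ] ∃[ b ] ∃[ c ]
    (E v a × E v b × E v c × a ≢ b × a ≢ c × b ≢ c × Extension v a b c)

  extendedClaw? : Dec ExtendedClaw
  extendedClaw? = any? λ v → any? λ a → any? λ b → any? λ c →
    E? v a ×-dec E? v b ×-dec E? v c ×-dec ¬? (a ≟ᶠ b) ×-dec ¬? (a ≟ᶠ c) ×-dec ¬? (b ≟ᶠ c) ×-dec
    ((any? λ d → E? v d ×-dec ¬? (d ≟ᶠ a) ×-dec ¬? (d ≟ᶠ b) ×-dec ¬? (d ≟ᶠ c)) ⊎-dec
     (any? λ e → E? a e ×-dec ¬? (e ≟ᶠ v)))

  module WithoutExtendedClaw (no-claw : ¬ ExtendedClaw) where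

    -- Two distinct neighbours of w other than its swap exhibit an extended claw at
    -- the apex or at the near end of w.
    unswapped-neighbour-unique : ∀ {w y z} → w ~ y → w ~ z → y ≢ swapped w → z ≢ swapped w → y ≡ z
    unswapped-neighbour-unique (inj₂ (inj₁ (refl , refl , refl))) _ y≢s _ = ⊥-elim (y≢s refl)
    unswapped-neighbour-unique _ (inj₂ (inj₁ (refl , refl , refl))) _ z≢s = ⊥-elim (z≢s refl)
    unswapped-neighbour-unique {w} {y} {z} (inj₁ (refl , refl , q₁≢q)) (inj₁ (refl , refl , q₂≢q)) _ _
      with far y ≟ᶠ far z
    ... | yes refl = refl
    ... | no q₁≢q₂ = ⊥-elim (no-claw (apex w , near w , far w , far y ,
          apex~near w , apex~far w , apex~far y , near≢far w , near≢far y , ≢-sym q₁≢q ,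
          inj₁ (far z , apex~far z , ≢-sym (near≢far z) , q₂≢q , ≢-sym q₁≢q₂)))
    unswapped-neighbour-unique {w} {y} {z} (inj₁ (refl , refl , q₁≢q)) (inj₂ (inj₂ (refl , refl))) _ _ =
      ⊥-elim (no-claw (apex w , near w , far w , far y , apex~near w , apex~far w , apex~far y ,
          near≢far w , near≢far y , ≢-sym q₁≢q , inj₂ (far z , apex~far z , ≢-sym (near≢far z))))
    unswapped-neighbour-unique {w} {y} {z} (inj₂ (inj₂ (refl , refl))) (inj₁ (refl , refl , q₂≢q)) _ _ =
      ⊥-elim (no-claw (apex w , near w , far w , far z , apex~near w , apex~far w , apex~far z ,
          near≢far w , near≢far z , ≢-sym q₂≢q , inj₂ (far y , apex~far y , ≢-sym (near≢far y))))
    unswapped-neighbour-unique {w} {y} {z} (inj₂ (inj₂ (refl , refl))) (inj₂ (inj₂ (refl , refl))) _ _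
      with far y ≟ᶠ far z
    ... | yes refl = refl
    ... | no r₁≢r₂ = ⊥-elim (no-claw (near w , apex w , far y , far z ,
          E-sym (apex~near w) , apex~far y , apex~far z , near≢far y , near≢far z , r₁≢r₂ ,
          inj₂ (far w , apex~far w , ≢-sym (near≢far w))))

    degree≤2 : ∀ {w y z u} → w ~ y → w ~ z → w ~ u → y ≡ z ⊎ y ≡ u ⊎ z ≡ u
    degree≤2 {w} {y} {z} {u} w~y w~z w~u with y ≟ᵂ swapped w | z ≟ᵂ swapped w | u ≟ᵂ swapped w
    ... | yes refl | yes refl | _ = inj₁ refl
    ... | yes refl | no _ | yes refl = inj₂ (inj₁ refl)
    ... | yes refl | no z≢s | no u≢s = inj₂ (inj₂ (unswapped-neighbour-unique {w} w~z w~u z≢s u≢s))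
    ... | no _ | yes refl | yes refl = inj₂ (inj₂ refl)
    ... | no y≢s | yes refl | no u≢s = inj₂ (inj₁ (unswapped-neighbour-unique {w} w~y w~u y≢s u≢s))
    ... | no y≢s | no z≢s | _ = inj₁ (unswapped-neighbour-unique {w} w~y w~z y≢s z≢s)

    wedge-graph-cycle⊎path : (w₀ : Wedge) → (∀ u v → Reach G u v) → IsCycle KG ⊎ IsPath KG
    wedge-graph-cycle⊎path w₀ connected =
      Sum.map (λ (k , 3≤k , iso) → k , 3≤k , transport iso) (λ (k , 1≤k , iso) → k , 1≤k , transport iso)
        (MaxDegreeTwo.connected⇒cycle⊎path _≟ᵂ_ _~_
          (λ w w' → neighbour? _≟ᶠ_ (corners w) (corners w')) (λ {w} {w'} → ~-sym {w} {w'})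
          (λ {w} → ~-irrefl {w}) (λ {w} {y} {z} {u} → degree≤2 {w} {y} {z} {u})
          search-wedge code code-injective w₀ wedges-connected)
      where
      open Classification w₀ connected
      transport : ∀ {k R} → IsoToFin Γ k R → IsoToFin KG k R
      transport = IsoToFin-transport KG bicliqueOf bicliqueSet-injective
                    (λ _ _ → adjacent⇒~ , ~⇒adjacent) biclique≈wedge

  module Necklace (connected : ∀ u v → Reach G u v) (v a b c : Vertex) (va : E v a) (vb : E v b) (vc : E v c)
                  (a≢b : a ≢ b) (a≢c : a ≢ c) (b≢c : b ≢ c) (extension : Extension v a b c) where

    σ : Fin 4 → Vertex
    σ 0F = v
    σ 1F = a
    σ 2F = b
    σ 3F = c

    σ-injective : ∀ {x y} → σ x ≡ σ y → x ≡ y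
    σ-injective {0F} {0F} _ = refl
    σ-injective {1F} {1F} _ = refl
    σ-injective {2F} {2F} _ = refl
    σ-injective {3F} {3F} _ = refl
    σ-injective {0F} {1F} e = ⊥-elim (E⇒≢ va e)
    σ-injective {0F} {2F} e = ⊥-elim (E⇒≢ vb e)
    σ-injective {0F} {3F} e = ⊥-elim (E⇒≢ vc e)
    σ-injective {1F} {0F} e = ⊥-elim (E⇒≢ va (sym e))
    σ-injective {1F} {2F} e = ⊥-elim (a≢b e)
    σ-injective {1F} {3F} e = ⊥-elim (a≢c e)
    σ-injective {2F} {0F} e = ⊥-elim (E⇒≢ vb (sym e))
    σ-injective {2F} {1F} e = ⊥-elim (a≢b (sym e))
    σ-injective {2F} {3F} e = ⊥-elim (b≢c e)
    σ-injective {3F} {0F} e = ⊥-elim (E⇒≢ vc (sym e))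
    σ-injective {3F} {1F} e = ⊥-elim (a≢c (sym e))
    σ-injective {3F} {2F} e = ⊥-elim (b≢c (sym e))

    spoke : ∀ x → x ≢ 0F → E v (σ x)
    spoke 0F x≢0 = ⊥-elim (x≢0 refl)
    spoke 1F _ = va
    spoke 2F _ = vb
    spoke 3F _ = vc

    cycleWedge : Fin 6 → Wedge
    cycleWedge i = wedge v (σ (nearLabel i)) (σ (farLabel i))
      (spoke _ (nearLabel≢0 i)) (spoke _ (farLabel≢0 i)) (λ e → nearLabel≢farLabel i (σ-injective e))

    cycleWedge-adjacency : ∀ i j → (cycleWedge i ~ cycleWedge j) ⟺ CycleAdj 6 i j
    cycleWedge-adjacency i j =
      ⟺-trans (Neighbour-map σ σ-injective (cycleCorners i) (cycleCorners j)) (cycleCorners-cycle i j)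

    record Pendant : Set where
      field
        pendant    : Wedge
        off-cycle  : ∀ i → pendant ≢ cycleWedge i
        attachment : ∀ i → (pendant ~ cycleWedge i) ⟺ (σ (nearLabel i) ≡ a)

    pendantOf : Extension v a b c → Pendant
    pendantOf (inj₁ (d , vd , d≢a , d≢b , d≢c)) = record
      { pendant    = wedge v a d va vd (≢-sym d≢a)
      ; off-cycle  = λ i e → fresh (farLabel i) (farLabel≢0 i) (cong far e)
      ; attachment = λ i →
          (λ { (inj₁ (_ , n≡a , _)) → n≡a
             ; (inj₂ (inj₁ (_ , n≡d , _))) → ⊥-elim (fresh (nearLabel i) (nearLabel≢0 i) (sym n≡d))
             ; (inj₂ (inj₂ (v≡a , _))) → ⊥-elim (E⇒≢ va v≡a) }) ,
          λ n≡a → inj₁ (refl , n≡a , λ f≡d → fresh (farLabel i) (farLabel≢0 i) (sym f≡d))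
      }
      where
      fresh : ∀ x → x ≢ 0F → d ≢ σ x
      fresh 0F x≢0 _ = x≢0 refl
      fresh 1F _ = d≢a
      fresh 2F _ = d≢b
      fresh 3F _ = d≢c
    pendantOf (inj₂ (e , ae , e≢v)) = record
      { pendant    = wedge a v e (E-sym va) ae (≢-sym e≢v)
      ; off-cycle  = λ i a≡v → E⇒≢ va (sym (cong apex a≡v))
      ; attachment = λ i →
          (λ { (inj₁ (v≡a , _)) → ⊥-elim (E⇒≢ va v≡a)
             ; (inj₂ (inj₁ (v≡a , _))) → ⊥-elim (E⇒≢ va v≡a)
             ; (inj₂ (inj₂ (_ , n≡a))) → n≡a }) ,
          λ n≡a → inj₂ (inj₂ (refl , n≡a))
      }

    open Pendant (pendantOf extension)

    attached : ∀ i → (pendant ~ cycleWedge i) ⟺ (toℕ i ≡ 0 ⊎ toℕ i ≡ 1)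
    attached i = ⟺-trans (attachment i) (⟺-trans (σ-injective , cong σ) (cycleLabel-attached i))

    necklaceWedge : Fin 6 ⊎ Fin 1 → Wedge
    necklaceWedge (inj₁ i) = cycleWedge i
    necklaceWedge (inj₂ _) = pendant

    necklaceWedge-adjacency : ∀ x y → (necklaceWedge x ~ necklaceWedge y) ⟺ NecklaceAdj 6 1 x y
    necklaceWedge-adjacency (inj₁ i) (inj₁ j) = cycleWedge-adjacency i j
    necklaceWedge-adjacency (inj₁ i) (inj₂ 0F) =
      ⟺-trans (~-sym {cycleWedge i} {pendant} , ~-sym {pendant} {cycleWedge i}) (attached i)
    necklaceWedge-adjacency (inj₂ 0F) (inj₁ j) = attached j
    necklaceWedge-adjacency (inj₂ 0F) (inj₂ 0F) =
      (λ p~p → ⊥-elim (~-irrefl {pendant} p~p)) , (λ 0≢0 → ⊥-elim (0≢0 refl))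

    necklaceWedge-injective : ∀ x y → necklaceWedge x ≡ necklaceWedge y → x ≡ y
    necklaceWedge-injective (inj₁ i) (inj₁ j) e =
      cong inj₁ (cycleLabel-injective i j (cong₂ _,_ (σ-injective (cong near e)) (σ-injective (cong far e))))
    necklaceWedge-injective (inj₁ i) (inj₂ 0F) e = ⊥-elim (off-cycle i (sym e))
    necklaceWedge-injective (inj₂ 0F) (inj₁ j) e = ⊥-elim (off-cycle j e)
    necklaceWedge-injective (inj₂ 0F) (inj₂ 0F) _ = refl

    necklaceBiclique : Fin 6 ⊎ Fin 1 → V KG
    necklaceBiclique x = bicliqueOf (necklaceWedge x)

    necklace-embedding : InducedEmbedding KG (NecklaceAdj 6 1) necklaceBiclique
    necklace-embedding =
      (λ x y same → necklaceWedge-injective x y (bicliqueSet-injective same)) ,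
      (λ x y → ⟺-trans (adjacent⇒~ {necklaceWedge x} {necklaceWedge y} , ~⇒adjacent)
                        (necklaceWedge-adjacency x y))

    open Classification (cycleWedge 0F) connected

    -- The swap case cannot occur: the swap of a cycle wedge is again a cycle wedge.
    off-cycle-neighbour : ∀ {t} m → t ~ cycleWedge m → (∀ m' → t ≢ cycleWedge m') →
      (apex t ≡ v × near t ≡ σ (nearLabel m)) ⊎ (apex t ≡ σ (nearLabel m) × near t ≡ v)
    off-cycle-neighbour m (inj₁ (v≡ , n≡ , _)) _ = inj₁ (sym v≡ , sym n≡)
    off-cycle-neighbour m (inj₂ (inj₂ (v≡ , n≡))) _ = inj₂ (sym n≡ , sym v≡)
    off-cycle-neighbour m (inj₂ (inj₁ (v≡ , n≡ , f≡))) off with cycleLabel-swap m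
    ... | j , label-j = ⊥-elim (off j (corners-injective (cong₂ _,_ (sym v≡) (cong₂ _,_
            (trans (sym f≡) (cong (λ l → σ (proj₁ l)) (sym label-j)))
            (trans (sym n≡) (cong (λ l → σ (proj₂ l)) (sym label-j)))))))

    -- The hypothesis is never met: no biclique off the cycle is adjacent to two
    -- cycle wedges at distance two.
    good-neighbours : GoodNeighbors KG 6 (λ i → necklaceBiclique (inj₁ i))
    good-neighbours S off i j k i→j j→k S~i S~k with biclique≈wedge S
    ... | t , t≈S =
      ⊥-elim (apart (off-cycle-neighbour i (t~ i S~i) off-t) (off-cycle-neighbour k (t~ k S~k) off-t))
      where
      off-t : ∀ m → t ≢ cycleWedge m
      off-t m t≡m = off m (subst (λ u → _≈_ KG (bicliqueOf u) S) t≡m t≈S)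
      t~ : ∀ m → Adj KG S (bicliqueOf (cycleWedge m)) → t ~ cycleWedge m
      t~ m S~m = adjacent⇒~ {t} {cycleWedge m}
        (KBe-adjacent-respˡ {G} {S} {bicliqueOf t} {bicliqueOf (cycleWedge m)} (λ d → sym (t≈S d)) S~m)
      spread : nearLabel i ≢ nearLabel k
      spread = cycleLabel-spread i j k i→j j→k
      v≢σ : ∀ m → v ≢ σ (nearLabel m)
      v≢σ m e = nearLabel≢0 m (sym (σ-injective e))
      apart : (apex t ≡ v × near t ≡ σ (nearLabel i)) ⊎ (apex t ≡ σ (nearLabel i) × near t ≡ v) →
              (apex t ≡ v × near t ≡ σ (nearLabel k)) ⊎ (apex t ≡ σ (nearLabel k) × near t ≡ v) → ⊥
      apart (inj₁ (_ , n≡i)) (inj₁ (_ , n≡k)) = spread (σ-injective (trans (sym n≡i) n≡k))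
      apart (inj₁ (a≡v , _)) (inj₂ (a≡k , _)) = v≢σ k (trans (sym a≡v) a≡k)
      apart (inj₂ (a≡i , _)) (inj₁ (a≡v , _)) = v≢σ i (trans (sym a≡v) a≡i)
      apart (inj₂ (a≡i , _)) (inj₂ (a≡k , _)) = spread (σ-injective (trans (sym a≡i) a≡k))

    necklace : HasGoodNecklace KG
    necklace = 6 , 1 , s≤s (s≤s (s≤s (s≤s (s≤s (s≤s z≤n))))) , s≤s z≤n ,
               necklaceBiclique , necklace-embedding , good-neighbours

proposition3 : (H : SimpleGraph) → Connected (toGraph H) → Connected (Burgeon H) →
    IsCycle (KBe (Burgeon H)) ⊎ IsPath (KBe (Burgeon H)) ⊎ HasGoodNecklace (KBe (Burgeon H))
proposition3 H _ (d₀ , connected) = by-cases extendedClaw? wedge?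
  where
  open BurgeonBicliques H
  by-cases : Dec ExtendedClaw → Dec Wedge → IsCycle KG ⊎ IsPath KG ⊎ HasGoodNecklace KG
  by-cases (yes (v , a , b , c , va , vb , vc , a≢b , a≢c , b≢c , extension)) _ =
    inj₂ (inj₂ (Necklace.necklace connected v a b c va vb vc a≢b a≢c b≢c extension))
  by-cases (no no-claw) (yes w₀) =
    Sum.map₂ inj₁ (WithoutExtendedClaw.wedge-graph-cycle⊎path no-claw w₀ connected)
  by-cases (no _) (no no-wedge) = inj₂ (inj₁ (WithoutWedge.single-vertex-path no-wedge d₀ connected))
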